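{- Let $P$ be a slant irreducible $\Gamma$-colored $d$-complete poset and assume $\Gamma$ is simply laced. If the top tree $T$ contains more than one element, then $T$ has shape $Y(i;j,k)$ for some integers $i\ge1$ and $k\ge j\ge1$.
   Context: Dynkin diagram $\Gamma$: finite set with integers $\theta_{ab}$, $\theta_{aa}=2$, $\theta_{ab}\le0$ ($a\ne b$), $\theta_{ab}=0\iff\theta_{ba}=0$; $a\sim b$ if $a\ne b$ and $\theta_{ab}<0$; simply laced: all $\theta_{ab}\in\{ -1,0,2\}$. $\Gamma$-colored poset: poset with surjective $\kappa:P\to\Gamma$. Consecutive elements of color $a$: $x<y$ of color $a$, no color-$a$ element in $(x,y)$. $U(x,P)=\{y>x:\kappa(y)\sim\kappa(x)\}$. $\Gamma$-colored $d$-complete: locally finite with (EC) equal colors comparable; (NA) neighbors (one covers the other) have adjacent colors; (AC) adjacent colors comparable; (ICE2) consecutive $x<y$ of color $a$ have $\sum_{z\in(x,y)}-\theta_{\kappa(z),a}=2$; (UCB1) for maximal $x$ of color $a$, $U(x,P)$ finite and $\sum_{y\in U(x,P)}-\theta_{\kappa(y),a}\le1$. The top tree $T$ of finite $P$ is the set of elements maximal among elements of their color. A finite such $P$ is slant irreducible if connected and whenever $x,y\in T$ with $y$ covering $x$, $y$ is not the only element of its color in $P$. $T$ has shape $Y(i;j,k)$ if, as a poset, it consists of a chain $t_1>\dots>t_i$ and two disjoint chains $u_1>\dots>u_j$, $v_1>\dots>v_k$, where $t_i$ covers $u_1$ and $v_1$, with no other covering relations. -}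

module Defs where

open import Level using (0ℓ)
open import Data.Nat as ℕ using (ℕ; zero; suc; _∸_)
open import Data.Integer as ℤ using (ℤ; +_; -_; -1ℤ; 0ℤ; 1ℤ)
open import Data.Integer.Properties as ℤP using ()
open import Data.Fin using (Fin; toℕ; _≟_)
open import Data.List using (List; foldr; map; filter; allFin)
open import Data.Product using (Σ; ∃; ∃-syntax; _×_; _,_)
open import Data.Product.Relation.Binary.Pointwise.NonDependent using ()
open import Data.Sum using (_⊎_; inj₁; inj₂)
open import Data.Empty using (⊥)
open import Relation.Nullary using (¬_; Dec; yes; no)
open import Relation.Nullary.Decidable using (_×-dec_; ¬?)
open import Relation.Binary using (IsPartialOrder; Decidable)
open import Relation.Binary.PropositionalEquality using (_≡_; _≢_)
open import Relation.Binary.Construct.Closure.ReflexiveTransitive using (Star)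

record Dynkin : Set where
  field
    n       : ℕ
    θ       : Fin n → Fin n → ℤ
    θ-diag  : ∀ a → θ a a ≡ + 2
    θ-nonpos : ∀ a b → a ≢ b → θ a b ℤ.≤ 0ℤ
    θ-zero  : ∀ a b → θ a b ≡ 0ℤ → θ b a ≡ 0ℤ   -- (with a,b swapped this gives the iff)

module _ (Γ : Dynkin) where
  open Dynkin Γ

  Adj : Fin n → Fin n → Set
  Adj a b = (a ≢ b) × (θ a b ℤ.< 0ℤ)

  Adj? : ∀ a b → Dec (Adj a b)
  Adj? a b = ¬? (a ≟ b) ×-dec (θ a b ℤ.<? 0ℤ)

  SimplyLaced : Set
  SimplyLaced = ∀ a b → (θ a b ≡ -1ℤ) ⊎ (θ a b ≡ 0ℤ) ⊎ (θ a b ≡ + 2)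

record ColoredPoset (Γ : Dynkin) : Set₁ where
  open Dynkin Γ
  field
    m         : ℕ
    _≤P_      : Fin m → Fin m → Set
    isPO      : IsPartialOrder _≡_ _≤P_
    _≤P?_     : Decidable _≤P_
    κ         : Fin m → Fin n
    κ-surj    : ∀ a → ∃[ x ] κ x ≡ a

module Poset {Γ : Dynkin} (P : ColoredPoset Γ) where
  open Dynkin Γ public
  open ColoredPoset P public

  _<P_ : Fin m → Fin m → Set
  x <P y = (x ≤P y) × (x ≢ y)

  _<P?_ : Decidable _<P_
  x <P? y = (x ≤P? y) ×-dec ¬? (x ≟ y)

  Comparable : Fin m → Fin m → Set
  Comparable x y = (x ≤P y) ⊎ (y ≤P x)

  Covers : Fin m → Fin m → Set
  Covers y x = (x <P y) × (∀ z → x <P z → z <P y → ⊥)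

  sumOver : {Q : Fin m → Set} → (∀ x → Dec (Q x)) → (Fin m → ℤ) → ℤ
  sumOver Q? f = foldr ℤ._+_ 0ℤ (map f (filter Q? (allFin m)))

  inInterval : Fin m → Fin m → Fin m → Set
  inInterval x y z = (x <P z) × (z <P y)

  inInterval? : ∀ x y z → Dec (inInterval x y z)
  inInterval? x y z = (x <P? z) ×-dec (z <P? y)

  inU : Fin m → Fin m → Set
  inU x y = (x <P y) × Adj Γ (κ y) (κ x)

  inU? : ∀ x y → Dec (inU x y)
  inU? x y = (x <P? y) ×-dec Adj? Γ (κ y) (κ x)

  MaxInColor : Fin m → Set
  MaxInColor x = ∀ y → κ y ≡ κ x → ¬ (x <P y)

  -- d-completeness axioms (local finiteness and finiteness of U(x,P)
  -- hold automatically since P is finite)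
  EC : Set
  EC = ∀ x y → κ x ≡ κ y → Comparable x y

  NA : Set
  NA = ∀ x y → Covers y x → Adj Γ (κ x) (κ y)

  AC : Set
  AC = ∀ x y → Adj Γ (κ x) (κ y) → Comparable x y

  ICE2 : Set
  ICE2 = ∀ x y → x <P y → κ x ≡ κ y →
         (∀ z → x <P z → z <P y → κ z ≢ κ x) →
         sumOver (inInterval? x y) (λ z → - θ (κ z) (κ x)) ≡ + 2

  UCB1 : Set
  UCB1 = ∀ x → MaxInColor x →
         sumOver (inU? x) (λ y → - θ (κ y) (κ x)) ℤ.≤ 1ℤ

  DComplete : Set
  DComplete = EC × NA × AC × ICE2 × UCB1

  inT : Fin m → Set
  inT = MaxInColor

  Connected : Set
  Connected = ∀ x y → Star Comparable x y

  SlantIrreducible : Set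
  SlantIrreducible =
    Connected ×
    (∀ x y → inT x → inT y → Covers y x → ∃[ z ] (z ≢ y × κ z ≡ κ y))

  TCovers : Fin m → Fin m → Set
  TCovers y x = inT x × inT y × (x <P y) ×
                (∀ z → inT z → x <P z → z <P y → ⊥)

-- The poset Y(i;j,k): chain t_1 > ... > t_i (indices 0..i-1), chains
-- u_1 > ... > u_j and v_1 > ... > v_k, with t_i covering u_1 and v_1.

YElem : ℕ → ℕ → ℕ → Set
YElem i j k = Fin i ⊎ Fin j ⊎ Fin k

data YCov (i j k : ℕ) : YElem i j k → YElem i j k → Set where
  tt : ∀ r s → toℕ s ≡ suc (toℕ r) → YCov i j k (inj₁ r) (inj₁ s)
  uu : ∀ r s → toℕ s ≡ suc (toℕ r) → YCov i j k (inj₂ (inj₁ r)) (inj₂ (inj₁ s))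
  vv : ∀ r s → toℕ s ≡ suc (toℕ r) → YCov i j k (inj₂ (inj₂ r)) (inj₂ (inj₂ s))
  tu : ∀ r s → toℕ r ≡ i ∸ 1 → toℕ s ≡ 0 → YCov i j k (inj₁ r) (inj₂ (inj₁ s))
  tv : ∀ r s → toℕ r ≡ i ∸ 1 → toℕ s ≡ 0 → YCov i j k (inj₁ r) (inj₂ (inj₂ s))

module _ {Γ : Dynkin} (P : ColoredPoset Γ) where
  open Poset P

  -- T has shape Y(i;j,k): an isomorphism of posets (described through
  -- covering relations) between Y(i;j,k) and T
  HasShapeY : ℕ → ℕ → ℕ → Set
  HasShapeY i j k =
    Σ (YElem i j k → Fin m) λ φ →
      (∀ p q → φ p ≡ φ q → p ≡ q) ×
      (∀ p → inT (φ p)) ×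
      (∀ x → inT x → ∃[ p ] φ p ≡ x) ×
      (∀ p q → YCov i j k p q → TCovers (φ p) (φ q)) ×
      (∀ p q → TCovers (φ p) (φ q) → YCov i j k p q)

  TMoreThanOne : Set
  TMoreThanOne = ∃[ x ] ∃[ y ] (inT x × inT y × x ≢ y)

-- In the simply laced case the weights -θ between distinct colours are 0 or 1, so UCB1
-- says that an element x of the top tree T has at most one element above it of a colour
-- adjacent to its own, and ICE2 says that the open interval between consecutive elements
-- of one colour contains exactly two elements of colours adjacent to it.  The first fact
-- makes T upward closed with every element of T covered by at most one element, so T is a
-- tree hanging from the maximum R of P (connectedness puts all of P below R).
-- Descend from R while the current node x has an element of its own colour below it and
-- no element of its parent's colour in the gap below it: the two adjacent elements in
-- that gap have tops that are children of x, so x has either exactly two children (the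
-- branch point) or one child, which inherits the invariant.  Below each of the two
-- children, slant irreducibility supplies a gap which already contains an element of the
-- parent's colour, leaving room for only one child: both branches are chains.

module Submission where

open import Defs
open import Data.Nat using (_≤_)
open import Data.Product using (_×_; ∃-syntax)

open import Level using (0ℓ)
open import Data.Empty using (⊥-elim)
open import Data.Fin using (Fin; zero; suc; toℕ; fromℕ; fromℕ<; inject₁; _≟_)
import Data.Fin.Properties as FinP
open import Data.Fin.Induction using (po-wellFounded; po-noetherian)
open import Data.Integer as ℤ using (ℤ; +_; -_; 0ℤ; 1ℤ; -1ℤ)
import Data.Integer.Properties as ℤP
open import Data.List using (List; []; _∷_; foldr; map; filter; length; allFin)
open import Data.List.Membership.Propositional using (_∈_)
open import Data.List.Membership.Propositional.Properties using (∈-allFin; ∈-filter⁺; ∈-filter⁻)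
open import Data.List.Relation.Unary.All using ([]; _∷_)
open import Data.List.Relation.Unary.AllPairs using ([]; _∷_)
open import Data.List.Relation.Unary.Any using (here; there)
open import Data.List.Relation.Unary.Unique.Propositional using (Unique)
open import Data.List.Relation.Unary.Unique.Propositional.Properties using (allFin⁺; filter⁺)
open import Data.Nat as ℕ using (ℕ; z≤n; s≤s)
import Data.Nat.Properties as ℕP
open import Data.Product using (_,_; proj₁; proj₂)
open import Data.Sum using (_⊎_; inj₁; inj₂; [_,_]′; map₁; swap)
open import Data.Unit using (⊤; tt)
open import Function using (_∘_; id; flip; _⇔_; mk⇔; Equivalence)
open import Function.Properties.Equivalence using (⇔-isEquivalence)
open import Induction.WellFounded using (Acc; acc)
open import Relation.Binary using (IsPartialOrder; IsEquivalence)
open import Relation.Binary.Construct.Closure.ReflexiveTransitive using (Star; ε; _◅_)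
open import Relation.Binary.Definitions using (tri<; tri≈; tri>)
open import Relation.Binary.PropositionalEquality
  using (_≡_; _≢_; refl; sym; trans; cong; cong₂; subst; subst₂)
open import Relation.Nullary using (¬_; Dec; yes; no)
open import Relation.Nullary.Decidable using (_×-dec_; ¬?; map′; decidable-stable)

private
  module ⇔ = IsEquivalence (⇔-isEquivalence {ℓ = 0ℓ})

module _ {A : Set} where

  ∈-tail : ∀ {x y : A} {xs} → x ∈ y ∷ xs → x ≢ y → x ∈ xs
  ∈-tail (here x≡y)   x≢y = ⊥-elim (x≢y x≡y)
  ∈-tail (there x∈xs) _   = x∈xs

  ∈⇒1≤length : ∀ {x : A} {xs} → x ∈ xs → 1 ≤ length xs
  ∈⇒1≤length {xs = _ ∷ _} _ = s≤s z≤n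

  distinct₂⇒2≤length : ∀ {x y : A} {xs} → x ∈ xs → y ∈ xs → x ≢ y → 2 ≤ length xs
  distinct₂⇒2≤length (here refl) y∈ x≢y = s≤s (∈⇒1≤length (∈-tail y∈ (x≢y ∘ sym)))
  distinct₂⇒2≤length (there x∈) (here refl) _ = s≤s (∈⇒1≤length x∈)
  distinct₂⇒2≤length (there x∈) (there y∈) x≢y =
    ℕP.m≤n⇒m≤1+n (distinct₂⇒2≤length x∈ y∈ x≢y)

  distinct₃⇒3≤length : ∀ {x y z : A} {xs} → x ∈ xs → y ∈ xs → z ∈ xs →
                       x ≢ y → x ≢ z → y ≢ z → 3 ≤ length xs
  distinct₃⇒3≤length (here refl) y∈ z∈ x≢y x≢z y≢z =
    s≤s (distinct₂⇒2≤length (∈-tail y∈ (x≢y ∘ sym)) (∈-tail z∈ (x≢z ∘ sym)) y≢z)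
  distinct₃⇒3≤length (there x∈) (here refl) z∈ _ x≢z y≢z =
    s≤s (distinct₂⇒2≤length x∈ (∈-tail z∈ (y≢z ∘ sym)) x≢z)
  distinct₃⇒3≤length (there x∈) (there y∈) (here refl) x≢y _ _ =
    s≤s (distinct₂⇒2≤length x∈ y∈ x≢y)
  distinct₃⇒3≤length (there x∈) (there y∈) (there z∈) x≢y x≢z y≢z =
    ℕP.m≤n⇒m≤1+n (distinct₃⇒3≤length x∈ y∈ z∈ x≢y x≢z y≢z)

  unique-constant⇒length≤1 : ∀ {z : A} {xs} → Unique xs → (∀ {x} → x ∈ xs → x ≡ z) →
                             length xs ≤ 1
  unique-constant⇒length≤1 []       _  = z≤n
  unique-constant⇒length≤1 (_ ∷ []) _  = s≤s z≤n
  unique-constant⇒length≤1 ((x≢y ∷ _) ∷ _) ≡z =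
    ⊥-elim (x≢y (trans (≡z (here refl)) (sym (≡z (there (here refl))))))

module _ {A : Set} {Q R : A → Set} (Q? : ∀ x → Dec (Q x)) (R? : ∀ x → Dec (R x)) (g : A → ℤ)
         (g-indicator : ∀ x → Q x → (R x → g x ≡ 1ℤ) × (¬ R x → g x ≡ 0ℤ)) where

  sum-filter≡length-filter :
    ∀ xs → foldr ℤ._+_ 0ℤ (map g (filter Q? xs)) ≡ + length (filter (λ x → Q? x ×-dec R? x) xs)
  sum-filter≡length-filter [] = refl
  sum-filter≡length-filter (x ∷ xs) with Q? x | R? x
  ... | no _  | _     = sum-filter≡length-filter xs
  ... | yes q | yes r = cong₂ ℤ._+_ (proj₁ (g-indicator x q) r) (sum-filter≡length-filter xs)
  ... | yes q | no ¬r =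
    trans (cong₂ ℤ._+_ (proj₂ (g-indicator x q) ¬r) (sum-filter≡length-filter xs))
          (ℤP.+-identityˡ _)

module _ {m} {Q : Fin m → Set} (Q? : ∀ x → Dec (Q x)) where

  none-one-or-two : (∀ x → ¬ Q x) ⊎ (∃[ x ] (Q x × (∀ y → Q y → y ≡ x))) ⊎
                    (∃[ x ] ∃[ y ] (Q x × Q y × x ≢ y))
  none-one-or-two with FinP.any? Q?
  ... | no ∄ = inj₁ (λ x q → ∄ (x , q))
  ... | yes (x , qx) with FinP.any? (λ y → Q? y ×-dec ¬? (y ≟ x))
  ...   | yes (y , qy , y≢x) = inj₂ (inj₂ (x , y , qx , qy , y≢x ∘ sym))
  ...   | no ∄ =
    inj₂ (inj₁ (x , qx , λ y qy → decidable-stable (y ≟ x) (λ y≢x → ∄ (y , qy , y≢x))))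

module SimplyLacedFacts (Γ : Dynkin) (SL : SimplyLaced Γ) where
  open Dynkin Γ

  private
    +2≰0 : ¬ (+ 2 ℤ.≤ 0ℤ)
    +2≰0 (ℤ.+≤+ ())

  Adj⇒θ≡-1 : ∀ {a b} → Adj Γ b a → θ b a ≡ -1ℤ
  Adj⇒θ≡-1 {a} {b} (_ , θ<0) with SL b a
  ... | inj₁ θ≡-1        = θ≡-1
  ... | inj₂ (inj₁ θ≡0) = ⊥-elim (ℤP.<-irrefl θ≡0 θ<0)
  ... | inj₂ (inj₂ θ≡2) = ⊥-elim (+2≰0 (ℤP.<⇒≤ (subst (ℤ._< 0ℤ) θ≡2 θ<0)))

  ¬Adj⇒θ≡0 : ∀ {a b} → b ≢ a → ¬ Adj Γ b a → θ b a ≡ 0ℤ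
  ¬Adj⇒θ≡0 {a} {b} b≢a ¬adj with SL b a
  ... | inj₁ θ≡-1        = ⊥-elim (¬adj (b≢a , subst (ℤ._< 0ℤ) (sym θ≡-1) ℤ.-<+))
  ... | inj₂ (inj₁ θ≡0) = θ≡0
  ... | inj₂ (inj₂ θ≡2) = ⊥-elim (+2≰0 (subst (ℤ._≤ 0ℤ) θ≡2 (θ-nonpos b a b≢a)))

  Adj-sym : ∀ {a b} → Adj Γ a b → Adj Γ b a
  Adj-sym {a} {b} (a≢b , θab<0) with Adj? Γ b a
  ... | yes b∼a = b∼a
  ... | no ¬b∼a =
    ⊥-elim (ℤP.<-irrefl (θ-zero b a (¬Adj⇒θ≡0 (a≢b ∘ sym) ¬b∼a)) θab<0)

  -θ-indicator : ∀ {a b} → b ≢ a →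
                 (Adj Γ b a → - θ b a ≡ 1ℤ) × (¬ Adj Γ b a → - θ b a ≡ 0ℤ)
  -θ-indicator b≢a = cong -_ ∘ Adj⇒θ≡-1 , cong -_ ∘ ¬Adj⇒θ≡0 b≢a

module PosetFacts {Γ : Dynkin} (P : ColoredPoset Γ) where
  open Poset P public
  open IsPartialOrder isPO public
    using (antisym) renaming (refl to ≤-refl; reflexive to ≤-reflexive; trans to ≤-trans)

  <⇒≤ : ∀ {x y} → x <P y → x ≤P y
  <⇒≤ = proj₁

  <-irrefl : ∀ {x y} → x ≡ y → ¬ (x <P y)
  <-irrefl x≡y (_ , x≢y) = x≢y x≡y

  <-≤-trans : ∀ {x y z} → x <P y → y ≤P z → x <P z
  <-≤-trans (x≤y , x≢y) y≤z = ≤-trans x≤y y≤z , λ { refl → x≢y (antisym x≤y y≤z) }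

  ≤-<-trans : ∀ {x y z} → x ≤P y → y <P z → x <P z
  ≤-<-trans x≤y (y≤z , y≢z) = ≤-trans x≤y y≤z , λ { refl → y≢z (antisym y≤z x≤y) }

  <-trans : ∀ {x y z} → x <P y → y <P z → x <P z
  <-trans x<y y<z = <-≤-trans x<y (<⇒≤ y<z)

  ≤⇒≡⊎< : ∀ {x y} → x ≤P y → x ≡ y ⊎ x <P y
  ≤⇒≡⊎< {x} {y} x≤y with x ≟ y
  ... | yes x≡y = inj₁ x≡y
  ... | no  x≢y = inj₂ (x≤y , x≢y)

  Adj⇒≢ : ∀ {x y} → Adj Γ (κ x) (κ y) → x ≢ y
  Adj⇒≢ (κx≢κy , _) = κx≢κy ∘ cong κ

  -- Opaque so that the type checker never unfolds these well-founded searches.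
  abstract
    max-above : {Q : Fin m → Set} → (∀ z → Dec (Q z)) → ∀ x → Q x →
                ∃[ y ] (Q y × x ≤P y × (∀ z → Q z → ¬ (y <P z)))
    max-above {Q} Q? x q = go x q (po-noetherian isPO x)
      where
      go : ∀ x → Q x → Acc (flip _<P_) x → ∃[ y ] (Q y × x ≤P y × (∀ z → Q z → ¬ (y <P z)))
      go x q (acc rs) with FinP.any? (λ z → Q? z ×-dec (x <P? z))
      ... | yes (z , qz , x<z) =
        let (y , qy , z≤y , maximal) = go z qz (rs x<z) in y , qy , ≤-trans (<⇒≤ x<z) z≤y , maximal
      ... | no ∄ = x , q , ≤-refl , λ z qz x<z → ∄ (z , qz , x<z)

    min-below : {Q : Fin m → Set} → (∀ z → Dec (Q z)) → ∀ x → Q x →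
                ∃[ y ] (Q y × y ≤P x × (∀ z → Q z → ¬ (z <P y)))
    min-below {Q} Q? x q = go x q (po-wellFounded isPO x)
      where
      go : ∀ x → Q x → Acc _<P_ x → ∃[ y ] (Q y × y ≤P x × (∀ z → Q z → ¬ (z <P y)))
      go x q (acc rs) with FinP.any? (λ z → Q? z ×-dec (z <P? x))
      ... | yes (z , qz , z<x) =
        let (y , qy , y≤z , minimal) = go z qz (rs z<x) in y , qy , ≤-trans y≤z (<⇒≤ z<x) , minimal
      ... | no ∄ = x , q , ≤-refl , λ z qz z<x → ∄ (z , qz , z<x)

  maximal-element : Fin m → ∃[ r ] (∀ z → ¬ (r <P z))
  maximal-element x =
    let (r , _ , _ , maximal) = max-above {Q = λ _ → ⊤} (λ _ → yes tt) x tt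
    in r , λ z → maximal z tt

  cover-above : ∀ {x z} → x <P z → ∃[ y ] (Covers y x × y ≤P z)
  cover-above {x} {z} x<z =
    let (y , (x<y , y≤z) , _ , minimal) =
          min-below (λ u → (x <P? u) ×-dec (u ≤P? z)) z (x<z , ≤-refl)
    in y , (x<y , λ u x<u u<y → minimal u (x<u , ≤-trans (<⇒≤ u<y) y≤z) u<y) , y≤z

  cover-below : ∀ {x z} → x <P z → ∃[ y ] (Covers z y × x ≤P y)
  cover-below {x} {z} x<z =
    let (y , (x≤y , y<z) , _ , maximal) =
          max-above (λ u → (x ≤P? u) ×-dec (u <P? z)) x (≤-refl , x<z)
    in y , (y<z , λ u y<u u<z → maximal u (≤-trans x≤y (<⇒≤ y<u) , u<z) y<u) , x≤y

  Covers? : ∀ y x → Dec (Covers y x)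
  Covers? y x = map′ (λ (x<y , ∄) → x<y , λ z x<z z<y → ∄ z (x<z , z<y))
                     (λ (x<y , ∄) → x<y , λ z (x<z , z<y) → ∄ z x<z z<y)
                     ((x <P? y) ×-dec FinP.all? (λ z → ¬? (inInterval? x y z)))

  inT? : ∀ x → Dec (inT x)
  inT? x = map′ (λ ∄ y κy≡κx x<y → ∄ y (κy≡κx , x<y))
                (λ max y (κy≡κx , x<y) → max y κy≡κx x<y)
                (FinP.all? (λ y → ¬? ((κ y ≟ κ x) ×-dec (x <P? y))))

  module _ {G : Fin m → Set} (cover-invariant : ∀ {x y} → Covers y x → G x ⇔ G y) where

    ≤-invariant : ∀ {x y} → x ≤P y → G x ⇔ G y
    ≤-invariant {x} {y} x≤y = go x x≤y (po-noetherian isPO x)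
      where
      go : ∀ x → x ≤P y → Acc (flip _<P_) x → G x ⇔ G y
      go x x≤y (acc rs) with ≤⇒≡⊎< x≤y
      ... | inj₁ refl = ⇔.refl
      ... | inj₂ x<y =
        let (c , c⋗x , c≤y) = cover-above x<y
        in ⇔.trans (cover-invariant c⋗x) (go c c≤y (rs (proj₁ c⋗x)))

    connected-invariant : ∀ {x y} → Star Comparable x y → G x ⇔ G y
    connected-invariant ε = ⇔.refl
    connected-invariant (inj₁ x≤z ◅ z⋯y) =
      ⇔.trans (≤-invariant x≤z) (connected-invariant z⋯y)
    connected-invariant (inj₂ z≤x ◅ z⋯y) =
      ⇔.trans (⇔.sym (≤-invariant z≤x)) (connected-invariant z⋯y)

  record TChain (x e : Fin m) : Set where
    field
      L          : ℕ
      c          : ℕ → Fin m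
      head       : c 0 ≡ x
      last       : c L ≡ e
      covers     : ∀ r → r ℕ.< L → Covers (c r) (c (ℕ.suc r))
      ∈T         : ∀ r → r ℕ.≤ L → inT (c r)
      decreasing : ∀ r r' → r ℕ.< r' → r' ℕ.≤ L → c r' <P c r
      complete   : ∀ y → inT y → y ≤P x → (∃[ r ] (r ℕ.≤ L × y ≡ c r)) ⊎ (y <P e)

    c-antitone : ∀ {r r'} → r ℕ.≤ r' → r' ℕ.≤ L → c r' ≤P c r
    c-antitone {r} {r'} r≤r' r'≤L with ℕP.m≤n⇒m<n∨m≡n r≤r'
    ... | inj₁ r<r' = <⇒≤ (decreasing r r' r<r' r'≤L)
    ... | inj₂ refl = ≤-refl

    c-≤-head : ∀ r → r ℕ.≤ L → c r ≤P x
    c-≤-head r r≤L = subst (c r ≤P_) head (c-antitone z≤n r≤L)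

    c-injective : ∀ {r r'} → r ℕ.≤ L → r' ℕ.≤ L → c r ≡ c r' → r ≡ r'
    c-injective {r} {r'} r≤L r'≤L eq with ℕP.<-cmp r r'
    ... | tri< r<r' _ _ = ⊥-elim (<-irrefl (sym eq) (decreasing r r' r<r' r'≤L))
    ... | tri≈ _ r≡r' _ = r≡r'
    ... | tri> _ _ r'<r = ⊥-elim (<-irrefl eq (decreasing r' r r'<r r≤L))

    at : Fin (ℕ.suc L) → Fin m
    at r = c (toℕ r)

    at-∈T : ∀ r → inT (at r)
    at-∈T r = ∈T _ (FinP.toℕ≤pred[n] r)

    at-≤-head : ∀ r → at r ≤P x
    at-≤-head r = c-≤-head _ (FinP.toℕ≤pred[n] r)

    last-≤-at : ∀ r → e ≤P at r
    last-≤-at r = subst (_≤P at r) last (c-antitone (FinP.toℕ≤pred[n] r) ℕP.≤-refl)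

    at-injective : ∀ {r r'} → at r ≡ at r' → r ≡ r'
    at-injective {r} {r'} =
      FinP.toℕ-injective ∘ c-injective (FinP.toℕ≤pred[n] r) (FinP.toℕ≤pred[n] r')

    at-head : ∀ r → toℕ r ≡ 0 → at r ≡ x
    at-head r r≡0 = trans (cong c r≡0) head

    at-last : ∀ r → toℕ r ≡ L → at r ≡ e
    at-last r r≡L = trans (cong c r≡L) last

    at-covers : ∀ r s → toℕ s ≡ ℕ.suc (toℕ r) → Covers (at r) (at s)
    at-covers r s s≡1+r =
      subst (λ k → Covers (at r) (c k)) (sym s≡1+r)
            (covers (toℕ r) (subst (ℕ._≤ L) s≡1+r (FinP.toℕ≤pred[n] s)))

    at-complete : ∀ y → inT y → y ≤P x → (∃[ r ] y ≡ at r) ⊎ (y <P e)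
    at-complete y y∈T y≤x =
      map₁ (λ (r , r≤L , y≡c) → fromℕ< (s≤s r≤L) , trans y≡c (cong c (sym (FinP.toℕ-fromℕ< _))))
           (complete y y∈T y≤x)

  single : ∀ {e} → inT e → TChain e e
  single {e} e∈T = record
    { L = 0 ; c = λ _ → e ; head = refl ; last = refl ; covers = λ _ ()
    ; ∈T = λ _ _ → e∈T ; decreasing = λ { _ _ r<r' z≤n → ⊥-elim (ℕP.n≮0 r<r') }
    ; complete = λ y _ y≤e → map₁ (λ y≡e → 0 , z≤n , y≡e) (≤⇒≡⊎< y≤e) }

  extend : ∀ {x x' e} → inT x → Covers x x' → (∀ y → inT y → y <P x → y ≤P x') →
           TChain x' e → TChain x e
  extend {x} {x'} {e} x∈T x⋗x' below C = record
    { L = ℕ.suc L ; c = c′ ; head = refl ; last = last ; covers = covers′ ; ∈T = ∈T′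
    ; decreasing = decreasing′ ; complete = complete′ }
    where
    open TChain C
    c′ : ℕ → Fin m
    c′ ℕ.zero    = x
    c′ (ℕ.suc r) = c r
    covers′ : ∀ r → r ℕ.< ℕ.suc L → Covers (c′ r) (c′ (ℕ.suc r))
    covers′ ℕ.zero    _         = subst (Covers x) (sym head) x⋗x'
    covers′ (ℕ.suc r) (s≤s r<L) = covers r r<L
    ∈T′ : ∀ r → r ℕ.≤ ℕ.suc L → inT (c′ r)
    ∈T′ ℕ.zero    _         = x∈T
    ∈T′ (ℕ.suc r) (s≤s r≤L) = ∈T r r≤L
    decreasing′ : ∀ r r' → r ℕ.< r' → r' ℕ.≤ ℕ.suc L → c′ r' <P c′ r
    decreasing′ ℕ.zero    (ℕ.suc r') _         (s≤s r'≤L) =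
      ≤-<-trans (c-≤-head r' r'≤L) (proj₁ x⋗x')
    decreasing′ (ℕ.suc r) (ℕ.suc r') (s≤s r<r') (s≤s r'≤L) = decreasing r r' r<r' r'≤L
    complete′ : ∀ y → inT y → y ≤P x → (∃[ r ] (r ℕ.≤ ℕ.suc L × y ≡ c′ r)) ⊎ (y <P e)
    complete′ y y∈T y≤x with ≤⇒≡⊎< y≤x
    ... | inj₁ y≡x = inj₁ (0 , z≤n , y≡x)
    ... | inj₂ y<x =
      map₁ (λ (r , r≤L , y≡c) → ℕ.suc r , s≤s r≤L , y≡c) (complete y y∈T (below y y∈T y<x))

module TopTree (Γ : Dynkin) (SL : SimplyLaced Γ) (P : ColoredPoset Γ)
               (ec : Poset.EC P) (na : Poset.NA P) (ac : Poset.AC P)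
               (ice2 : Poset.ICE2 P) (ucb1 : Poset.UCB1 P) (SI : Poset.SlantIrreducible P) where
  open PosetFacts P
  open SimplyLacedFacts Γ SL

  connected : Connected
  connected = proj₁ SI

  slant : ∀ x y → inT x → inT y → Covers y x → ∃[ z ] (z ≢ y × κ z ≡ κ y)
  slant = proj₂ SI

  top-exists : ∀ a → ∃[ t ] (κ t ≡ a × inT t)
  top-exists a =
    let (t , κt≡a , _ , maximal) = max-above (λ z → κ z ≟ a) _ (proj₂ (κ-surj a))
    in t , κt≡a , λ z κz≡κt → maximal z (trans κz≡κt κt≡a)

  top : Fin n → Fin m
  top a = proj₁ (top-exists a)

  κ-top : ∀ a → κ (top a) ≡ a
  κ-top a = proj₁ (proj₂ (top-exists a))

  top-∈T : ∀ a → inT (top a)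
  top-∈T a = proj₂ (proj₂ (top-exists a))

  ≤-T : ∀ {z t} → inT t → κ z ≡ κ t → z ≤P t
  ≤-T {z} {t} t∈T κz≡κt with ec z t κz≡κt
  ... | inj₁ z≤t = z≤t
  ... | inj₂ t≤z with ≤⇒≡⊎< t≤z
  ...   | inj₁ t≡z = ≤-reflexive (sym t≡z)
  ...   | inj₂ t<z = ⊥-elim (t∈T z κz≡κt t<z)

  T-colour-injective : ∀ {x y} → inT x → inT y → κ x ≡ κ y → x ≡ y
  T-colour-injective x∈T y∈T κx≡κy = antisym (≤-T y∈T κx≡κy) (≤-T x∈T (sym κx≡κy))

  ≤-top : ∀ z → z ≤P top (κ z)
  ≤-top z = ≤-T (top-∈T (κ z)) (sym (κ-top (κ z)))

  neighbours : {Q : Fin m → Set} → (∀ z → Dec (Q z)) → Fin n → List (Fin m)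
  neighbours Q? a = filter (λ z → Q? z ×-dec Adj? Γ (κ z) a) (allFin m)

  ∈-neighbours : ∀ {Q : Fin m → Set} (Q? : ∀ z → Dec (Q z)) {a z} → Q z → Adj Γ (κ z) a →
                 z ∈ neighbours Q? a
  ∈-neighbours Q? {a} q z∼a =
    ∈-filter⁺ (λ z → Q? z ×-dec Adj? Γ (κ z) a) (∈-allFin _) (q , z∼a)

  ∈-neighbours⁻ : ∀ {Q : Fin m → Set} (Q? : ∀ z → Dec (Q z)) {a z} → z ∈ neighbours Q? a →
                  Q z × Adj Γ (κ z) a
  ∈-neighbours⁻ Q? {a} = proj₂ ∘ ∈-filter⁻ (λ z → Q? z ×-dec Adj? Γ (κ z) a) {xs = allFin m}

  neighbours-unique : ∀ {Q : Fin m → Set} (Q? : ∀ z → Dec (Q z)) a → Unique (neighbours Q? a)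
  neighbours-unique Q? a = filter⁺ (λ z → Q? z ×-dec Adj? Γ (κ z) a) (allFin⁺ m)

  weighted-count : ∀ {Q : Fin m → Set} (Q? : ∀ z → Dec (Q z)) {a} → (∀ z → Q z → κ z ≢ a) →
                   sumOver Q? (λ z → - θ (κ z) a) ≡ + length (neighbours Q? a)
  weighted-count Q? {a} Q⇒≢ =
    sum-filter≡length-filter Q? (λ z → Adj? Γ (κ z) a) _
                             (λ z q → -θ-indicator (Q⇒≢ z q)) (allFin m)

  U-unique : ∀ {x y₁ y₂} → inT x → inU x y₁ → inU x y₂ → y₁ ≡ y₂
  U-unique {x} {y₁} {y₂} x∈T u₁ u₂ =
    decidable-stable (y₁ ≟ y₂) λ y₁≢y₂ →
      ℕP.<⇒≱ (distinct₂⇒2≤length (∈U u₁) (∈U u₂) y₁≢y₂)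
             (ℤP.drop‿+≤+ (subst (ℤ._≤ 1ℤ) (weighted-count (inU? x) (λ _ → proj₁ ∘ proj₂))
                                 (ucb1 x x∈T)))
    where
    ∈U : ∀ {y} → inU x y → y ∈ neighbours (inU? x) (κ x)
    ∈U u = ∈-neighbours (inU? x) u (proj₂ u)

  Consecutive : Fin m → Fin m → Set
  Consecutive w x = κ w ≡ κ x × w <P x × (∀ z → κ z ≡ κ x → w <P z → ¬ (z <P x))

  consecutive-below : ∀ {v x} → κ v ≡ κ x → v <P x → ∃[ w ] Consecutive w x
  consecutive-below {v} {x} κv≡κx v<x =
    let (w , (κw≡κx , w<x) , _ , maximal) =
          max-above (λ z → (κ z ≟ κ x) ×-dec (z <P? x)) v (κv≡κx , v<x)
    in w , κw≡κx , w<x , λ z κz≡κx w<z z<x → maximal z (κz≡κx , z<x) w<z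

  ≤-consecutive : ∀ {w x e} → Consecutive w x → κ e ≡ κ x → e <P x → e ≤P w
  ≤-consecutive {w} {x} {e} (κw≡κx , _ , between) κe≡κx e<x
    with ec e w (trans κe≡κx (sym κw≡κx))
  ... | inj₁ e≤w = e≤w
  ... | inj₂ w≤e with ≤⇒≡⊎< w≤e
  ...   | inj₁ w≡e = ≤-reflexive (sym w≡e)
  ...   | inj₂ w<e = ⊥-elim (between e κe≡κx w<e e<x)

  gap-colour-≢ : ∀ {w x z} → Consecutive w x → inInterval w x z → κ z ≢ κ w
  gap-colour-≢ (κw≡κx , _ , between) (w<z , z<x) κz≡κw = between _ (trans κz≡κw κw≡κx) w<z z<x

  GapNeighbour : Fin m → Fin m → Fin m → Set
  GapNeighbour w x z = inInterval w x z × Adj Γ (κ z) (κ x)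

  gap-neighbours-length : ∀ {w x} → Consecutive w x → length (neighbours (inInterval? w x) (κ x)) ≡ 2
  gap-neighbours-length {w} {x} cw@(κw≡κx , w<x , _) =
    subst (λ a → length (neighbours (inInterval? w x) a) ≡ 2) κw≡κx
      (ℤP.+-injective (trans (sym (weighted-count (inInterval? w x) (λ _ → gap-colour-≢ cw)))
                             (ice2 w x w<x κw≡κx (λ _ w<z z<x → gap-colour-≢ cw (w<z , z<x)))))

  gap-neighbour-among : ∀ {w x y₁ y₂ z} → Consecutive w x →
                        GapNeighbour w x y₁ → GapNeighbour w x y₂ → y₁ ≢ y₂ →
                        GapNeighbour w x z → z ≡ y₁ ⊎ z ≡ y₂
  gap-neighbour-among {w} {x} {y₁} {y₂} {z} cw n₁ n₂ y₁≢y₂ n with z ≟ y₁ | z ≟ y₂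
  ... | yes z≡y₁ | _        = inj₁ z≡y₁
  ... | no _     | yes z≡y₂ = inj₂ z≡y₂
  ... | no z≢y₁  | no z≢y₂  =
    ⊥-elim (ℕP.<⇒≱ (distinct₃⇒3≤length (∈gap n₁) (∈gap n₂) (∈gap n)
                                        y₁≢y₂ (z≢y₁ ∘ sym) (z≢y₂ ∘ sym))
                   (ℕP.≤-reflexive (gap-neighbours-length cw)))
    where
    ∈gap : ∀ {y} → GapNeighbour w x y → y ∈ neighbours (inInterval? w x) (κ x)
    ∈gap (y∈gap , y∼x) = ∈-neighbours (inInterval? w x) y∈gap y∼x

  another-gap-neighbour : ∀ {w x} → Consecutive w x → ∀ z₀ →
                          ∃[ z ] (GapNeighbour w x z × z ≢ z₀)
  another-gap-neighbour {w} {x} cw z₀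
    with FinP.any? (λ z → (inInterval? w x z ×-dec Adj? Γ (κ z) (κ x)) ×-dec ¬? (z ≟ z₀))
  ... | yes found = found
  ... | no ∄ =
    ⊥-elim (ℕP.<⇒≱ (ℕP.≤-reflexive (sym (gap-neighbours-length cw)))
                   (unique-constant⇒length≤1 (neighbours-unique (inInterval? w x) (κ x)) only-z₀))
    where
    only-z₀ : ∀ {z} → z ∈ neighbours (inInterval? w x) (κ x) → z ≡ z₀
    only-z₀ {z} z∈ = decidable-stable (z ≟ z₀) λ z≢z₀ →
      ∄ (z , ∈-neighbours⁻ (inInterval? w x) z∈ , z≢z₀)

  cover-Adj : ∀ {x y} → Covers y x → Adj Γ (κ y) (κ x)
  cover-Adj {x} {y} y⋗x = Adj-sym (na x y y⋗x)

  cover-of-T-unique : ∀ {x y₁ y₂} → inT x → Covers y₁ x → Covers y₂ x → y₁ ≡ y₂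
  cover-of-T-unique x∈T c₁ c₂ = U-unique x∈T (proj₁ c₁ , cover-Adj c₁) (proj₁ c₂ , cover-Adj c₂)

  cover-of-T-∈T : ∀ {x y} → inT x → Covers y x → inT y
  cover-of-T-∈T {x} {y} x∈T y⋗x z κz≡κy y<z =
    <-irrefl (U-unique x∈T (proj₁ y⋗x , cover-Adj y⋗x)
                           (<-trans (proj₁ y⋗x) y<z ,
                            subst (λ b → Adj Γ b (κ x)) (sym κz≡κy) (cover-Adj y⋗x)))
             y<z

  T-upward-closed : ∀ {x z} → inT x → x ≤P z → inT z
  T-upward-closed {x} {z} x∈T x≤z = go x x∈T x≤z (po-noetherian isPO x)
    where
    go : ∀ x → inT x → x ≤P z → Acc (flip _<P_) x → inT z
    go x x∈T x≤z (acc rs) with ≤⇒≡⊎< x≤z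
    ... | inj₁ refl = x∈T
    ... | inj₂ x<z =
      let (y , y⋗x , y≤z) = cover-above x<z
      in go y (cover-of-T-∈T x∈T y⋗x) y≤z (rs (proj₁ y⋗x))

  above-T-comparable : ∀ {x z₁ z₂} → inT x → x <P z₁ → x <P z₂ → Comparable z₁ z₂
  above-T-comparable {x} {z₁} {z₂} x∈T x<z₁ x<z₂ = go x x∈T x<z₁ x<z₂ (po-noetherian isPO x)
    where
    go : ∀ x → inT x → x <P z₁ → x <P z₂ → Acc (flip _<P_) x → Comparable z₁ z₂
    go x x∈T x<z₁ x<z₂ (acc rs) with cover-above x<z₁ | cover-above x<z₂
    ... | y , y⋗x , y≤z₁ | y' , y'⋗x , y'≤z₂ with cover-of-T-unique x∈T y⋗x y'⋗x
    ... | refl with ≤⇒≡⊎< y≤z₁ | ≤⇒≡⊎< y'≤z₂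
    ...   | inj₁ refl | _         = inj₁ y'≤z₂
    ...   | inj₂ _    | inj₁ refl = inj₂ y≤z₁
    ...   | inj₂ y<z₁ | inj₂ y<z₂ =
      go y (cover-of-T-∈T x∈T y⋗x) y<z₁ y<z₂ (rs (proj₁ y⋗x))

  Covers⇒TCovers : ∀ {x y} → inT x → Covers y x → TCovers y x
  Covers⇒TCovers x∈T y⋗x = x∈T , cover-of-T-∈T x∈T y⋗x , proj₁ y⋗x , λ z _ → proj₂ y⋗x z

  TCovers⇒Covers : ∀ {x y} → inT x → TCovers y x → Covers y x
  TCovers⇒Covers x∈T (_ , _ , x<y , ∄) = x<y , λ z x<z → ∄ z (T-upward-closed x∈T (<⇒≤ x<z)) x<z

  adjacent-above-T-covers : ∀ {x t} → inT x → x <P t → Adj Γ (κ t) (κ x) → Covers t x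
  adjacent-above-T-covers {x} x∈T x<t t∼x =
    let (c , c⋗x , _) = cover-above x<t
    in subst (λ u → Covers u x) (U-unique x∈T (proj₁ c⋗x , cover-Adj c⋗x) (x<t , t∼x)) c⋗x

  adjacent-T-covers : ∀ {x t} → inT x → inT t → Adj Γ (κ t) (κ x) → Covers t x ⊎ Covers x t
  adjacent-T-covers x∈T t∈T t∼x =
    [ (λ t≤x → inj₂ (adjacent-above-T-covers t∈T (t≤x , Adj⇒≢ t∼x) (Adj-sym t∼x)))
    , (λ x≤t → inj₁ (adjacent-above-T-covers x∈T (x≤t , Adj⇒≢ t∼x ∘ sym) t∼x))
    ]′ (ac _ _ t∼x)

  Child : Fin m → Fin m → Set
  Child x c = inT c × Covers x c

  Child? : ∀ x c → Dec (Child x c)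
  Child? x c = inT? c ×-dec Covers? x c

  Leaf : Fin m → Set
  Leaf x = ∀ d → ¬ Child x d

  only-child-≥ : ∀ {x c} → (∀ d → Child x d → d ≡ c) → ∀ y → inT y → y <P x → y ≤P c
  only-child-≥ only y y∈T y<x =
    let (d , x⋗d , y≤d) = cover-below y<x
    in subst (y ≤P_) (only d (T-upward-closed y∈T y≤d , x⋗d)) y≤d

  leaf-minimal : ∀ {e y} → Leaf e → inT y → ¬ (y <P e)
  leaf-minimal leaf y∈T y<e =
    let (d , e⋗d , y≤d) = cover-below y<e in leaf d (T-upward-closed y∈T y≤d , e⋗d)

  leaf-chain-complete : ∀ {d e y} (C : TChain d e) → Leaf e → inT y → y ≤P d →
                        ∃[ s ] y ≡ TChain.at C s
  leaf-chain-complete C leaf y∈T y≤d =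
    [ id , (λ y<e → ⊥-elim (leaf-minimal leaf y∈T y<e)) ]′ (TChain.at-complete C _ y∈T y≤d)

  StopOrOnlyChild : (I S : Fin m → Set) → Fin m → Set
  StopOrOnlyChild I S x = S x ⊎ ∃[ c ] (Child x c × (∀ d → Child x d → d ≡ c) × I c)

  descend : ∀ {I S : Fin m → Set} → (∀ {x} → I x → inT x) →
            (∀ {x} → I x → StopOrOnlyChild I S x) →
            ∀ {x} → I x → ∃[ e ] (TChain x e × S e)
  descend {I} {S} I⇒T step {x} i = go x i (po-wellFounded isPO x)
    where
    go : ∀ x → I x → Acc _<P_ x → ∃[ e ] (TChain x e × S e)
    go x i (acc rs) with step i
    ... | inj₁ s = x , single (I⇒T i) , s
    ... | inj₂ (c , (_ , x⋗c) , only , ic) =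
      let (e , C , s) = go c ic (rs (proj₁ x⋗c)) in e , extend (I⇒T i) x⋗c (only-child-≥ only) C , s

  child-in-gap : ∀ {w x c} → Consecutive w x → Covers x c → w <P c
  child-in-gap {w} {x} {c} (κw≡κx , w<x , _) x⋗c =
    [ (λ c≤w → ⊥-elim (proj₂ x⋗c w (c≤w , Adj⇒≢ c∼w) w<x))
    , (λ w≤c → w≤c , Adj⇒≢ c∼w ∘ sym) ]′ (ac c w c∼w)
    where
    c∼w : Adj Γ (κ c) (κ w)
    c∼w = subst (Adj Γ (κ c)) (sym κw≡κx) (na c x x⋗c)

  child-gap-neighbour : ∀ {w x c} → Consecutive w x → Child x c → GapNeighbour w x c
  child-gap-neighbour cw (_ , x⋗c) = (child-in-gap cw x⋗c , proj₁ x⋗c) , na _ _ x⋗c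

  -- The invariant along the two branches below the branch point.
  ParentInGaps : Fin m → Fin m → Set
  ParentInGaps x p = ∀ {w} → Consecutive w x → ∃[ e ] (κ e ≡ κ p × inInterval w x e)

  parent-in-gaps-of-child : ∀ {w x c a} → Consecutive w x → Child x c → GapNeighbour w x a →
                            κ a ≢ κ c → ParentInGaps c x
  parent-in-gaps-of-child {w} {x} {c} {a} cw ch@(_ , x⋗c) a-nb κa≢κc {w'} (κw'≡κc , w'<c , _) =
    [ (λ w'≤w → w , proj₁ cw , (w'≤w , Adj⇒≢ w'∼w) , child-in-gap cw x⋗c)
    , (λ w≤w' → ⊥-elim (w-≮-w' (w≤w' , Adj⇒≢ w'∼w ∘ sym))) ]′ (ac w' w w'∼w)
    where
    w'∼x : Adj Γ (κ w') (κ x)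
    w'∼x = subst (λ b → Adj Γ b (κ x)) (sym κw'≡κc) (na c x x⋗c)
    w'∼w : Adj Γ (κ w') (κ w)
    w'∼w = subst (Adj Γ (κ w')) (sym (proj₁ cw)) w'∼x
    w-≮-w' : ¬ (w <P w')
    w-≮-w' w<w' =
      [ (λ w'≡a → κa≢κc (trans (cong κ (sym w'≡a)) κw'≡κc))
      , (λ w'≡c → <-irrefl w'≡c w'<c) ]′
        (gap-neighbour-among cw a-nb (child-gap-neighbour cw ch) (κa≢κc ∘ cong κ)
                             ((w<w' , <-trans w'<c (proj₁ x⋗c)) , w'∼x))

  NoParentInGap : Fin m → Set
  NoParentInGap x = ∀ {p w z} → Covers p x → Consecutive w x → inInterval w x z → κ z ≢ κ p

  -- The invariant along the trunk from the root down to the branch point.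
  Trunk : Fin m → Set
  Trunk x = inT x × (∃[ v ] (κ v ≡ κ x × v <P x)) × NoParentInGap x

  Fork : Fin m → Set
  Fork β = ∃[ u ] ∃[ v ] (u ≢ v × Child β u × Child β v ×
                          (∀ d → Child β d → d ≡ u ⊎ d ≡ v) ×
                          ParentInGaps u β × ParentInGaps v β)

  module TrunkStep {x w} (x∈T : inT x) (x-npg : NoParentInGap x) (cw : Consecutive w x) where

    gap-neighbour-top-child : ∀ {z} → GapNeighbour w x z → Child x (top (κ z))
    gap-neighbour-top-child {z} (z∈gap , z∼x)
      with adjacent-T-covers x∈T (top-∈T (κ z))
                             (subst (λ b → Adj Γ b (κ x)) (sym (κ-top (κ z))) z∼x)
    ... | inj₁ top⋗x = ⊥-elim (x-npg top⋗x cw z∈gap (sym (κ-top (κ z))))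
    ... | inj₂ x⋗top = top-∈T (κ z) , x⋗top

    -- z is an element of colour κ c in the gap just below x, so every gap of colour κ c
    -- under c lies above that gap, while every element of colour κ x under x lies below it.
    only-child-trunk : ∀ {c z} → (∀ d → Child x d → d ≡ c) → GapNeighbour w x z → z ≢ c →
                       Trunk c
    only-child-trunk {c} {z} only z-nb@((w<z , _) , _) z≢c = c∈T , (z , κz≡κc , z<c) , c-npg
      where
      top≡c : top (κ z) ≡ c
      top≡c = only _ (gap-neighbour-top-child z-nb)
      c∈T : inT c
      c∈T = subst inT top≡c (top-∈T (κ z))
      x⋗c : Covers x c
      x⋗c = subst (Covers x) top≡c (proj₂ (gap-neighbour-top-child z-nb))
      κz≡κc : κ z ≡ κ c
      κz≡κc = trans (sym (κ-top (κ z))) (cong κ top≡c)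
      z<c : z <P c
      z<c = ≤-T c∈T κz≡κc , z≢c
      c-npg : NoParentInGap c
      c-npg p⋗c cw' (w'<e , e<c) κe≡κp with cover-of-T-unique c∈T p⋗c x⋗c
      ... | refl =
        <-irrefl refl (<-≤-trans (<-trans (<-≤-trans w<z (≤-consecutive cw' κz≡κc z<c)) w'<e)
                                 (≤-consecutive cw κe≡κp (<-trans e<c (proj₁ x⋗c))))

    fork-or-only-child : StopOrOnlyChild Trunk Fork x
    fork-or-only-child with none-one-or-two (Child? x)
    ... | inj₁ childless =
      let (_ , z-nb , _) = another-gap-neighbour cw x in ⊥-elim (childless _ (gap-neighbour-top-child z-nb))
    ... | inj₂ (inj₁ (c , ch , only)) =
      let (_ , z-nb , z≢c) = another-gap-neighbour cw c
      in inj₂ (c , ch , only , only-child-trunk only z-nb z≢c)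
    ... | inj₂ (inj₂ (c₁ , c₂ , ch₁ , ch₂ , c₁≢c₂)) =
      inj₁ (c₁ , c₂ , c₁≢c₂ , ch₁ , ch₂ ,
            (λ _ → gap-neighbour-among cw n₁ n₂ c₁≢c₂ ∘ child-gap-neighbour cw) ,
            parent-in-gaps-of-child cw ch₁ n₂ (κc₁≢κc₂ ∘ sym) ,
            parent-in-gaps-of-child cw ch₂ n₁ κc₁≢κc₂)
      where
      n₁ = child-gap-neighbour cw ch₁
      n₂ = child-gap-neighbour cw ch₂
      κc₁≢κc₂ : κ c₁ ≢ κ c₂
      κc₁≢κc₂ = c₁≢c₂ ∘ T-colour-injective (proj₁ ch₁) (proj₁ ch₂)

  trunk-step : ∀ {x} → Trunk x → StopOrOnlyChild Trunk Fork x
  trunk-step (x∈T , (_ , κv≡κx , v<x) , x-npg) =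
    let (_ , cw) = consecutive-below κv≡κx v<x in TrunkStep.fork-or-only-child x∈T x-npg cw

  Branch : Fin m → Set
  Branch x = inT x × ∃[ p ] (Covers p x × ParentInGaps x p)

  module BranchStep {x p w} (x∈T : inT x) (p⋗x : Covers p x) (x-gaps : ParentInGaps x p)
                    (cw : Consecutive w x) where

    e : Fin m
    e = proj₁ (x-gaps cw)

    κe≡κp : κ e ≡ κ p
    κe≡κp = proj₁ (proj₂ (x-gaps cw))

    e-nb : GapNeighbour w x e
    e-nb = proj₂ (proj₂ (x-gaps cw)) , subst (λ b → Adj Γ b (κ x)) (sym κe≡κp) (cover-Adj p⋗x)

    child-colour-≢ : ∀ {d} → Child x d → κ d ≢ κ e
    child-colour-≢ (d∈T , x⋗d) κd≡κe =
      <-irrefl (T-colour-injective d∈T (cover-of-T-∈T x∈T p⋗x) (trans κd≡κe κe≡κp))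
               (<-trans (proj₁ x⋗d) (proj₁ p⋗x))

    only-child : ∀ {c} → Child x c → ∀ d → Child x d → d ≡ c
    only-child ch d chd =
      [ (λ d≡e → ⊥-elim (child-colour-≢ chd (cong κ d≡e))) , id ]′
        (gap-neighbour-among cw e-nb (child-gap-neighbour cw ch) (child-colour-≢ ch ∘ cong κ ∘ sym)
                             (child-gap-neighbour cw chd))

    branch-of-child : ∀ {c} → Child x c → Branch c
    branch-of-child ch@(c∈T , x⋗c) =
      c∈T , x , x⋗c , parent-in-gaps-of-child cw ch e-nb (child-colour-≢ ch ∘ sym)

  branch-step : ∀ {x} → Branch x → StopOrOnlyChild Branch Leaf x
  branch-step {x} (x∈T , p , p⋗x , x-gaps) with FinP.any? (Child? x)
  ... | no ∄ = inj₁ (λ d ch → ∄ (d , ch))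
  ... | yes (c , ch@(c∈T , x⋗c)) =
    let (z , z≢x , κz≡κx) = slant c x c∈T x∈T x⋗c
        (_ , cw) = consecutive-below κz≡κx (≤-T x∈T κz≡κx , z≢x)
        open BranchStep x∈T p⋗x x-gaps cw
    in inj₂ (c , ch , only-child ch , branch-of-child ch)

  trunk-descent : ∀ {x} → Trunk x → ∃[ β ] (TChain x β × Fork β)
  trunk-descent = descend proj₁ trunk-step

  branch-descent : ∀ {x} → Branch x → ∃[ e ] (TChain x e × Leaf e)
  branch-descent = descend proj₁ branch-step

  siblings-incomparable : ∀ {β u v} → Covers β u → Covers β v → u ≢ v → ¬ (u ≤P v)
  siblings-incomparable β⋗u β⋗v u≢v u≤v =
    [ u≢v , (λ u<v → proj₂ β⋗u _ u<v (proj₁ β⋗v)) ]′ (≤⇒≡⊎< u≤v)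

  siblings-disjoint : ∀ {β u v y} → Covers β u → Covers β v → u ≢ v →
                      inT y → y ≤P u → ¬ (y ≤P v)
  siblings-disjoint β⋗u β⋗v u≢v y∈T y≤u y≤v with ≤⇒≡⊎< y≤u | ≤⇒≡⊎< y≤v
  ... | inj₁ refl | _         = siblings-incomparable β⋗u β⋗v u≢v y≤v
  ... | _         | inj₁ refl = siblings-incomparable β⋗v β⋗u (u≢v ∘ sym) y≤u
  ... | inj₂ y<u  | inj₂ y<v  =
    [ siblings-incomparable β⋗u β⋗v u≢v , siblings-incomparable β⋗v β⋗u (u≢v ∘ sym) ]′
      (above-T-comparable y∈T y<u y<v)

  module BelowRoot (R : Fin m) (R-maximal : ∀ z → ¬ (R <P z)) where

    R-∈T : inT R
    R-∈T z _ = R-maximal z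

    ≤R-upward : ∀ {a b} → inT a → a <P b → a ≤P R → b ≤P R
    ≤R-upward {a} {b} a∈T a<b a≤R with ≤⇒≡⊎< a≤R
    ... | inj₁ refl = ⊥-elim (R-maximal b a<b)
    ... | inj₂ a<R with above-T-comparable a∈T a<b a<R
    ...   | inj₁ b≤R = b≤R
    ...   | inj₂ R≤b = [ ≤-reflexive ∘ sym , ⊥-elim ∘ R-maximal b ]′ (≤⇒≡⊎< R≤b)

    top-≤R-adjacent : ∀ {a b} → Adj Γ a b → top a ≤P R → top b ≤P R
    top-≤R-adjacent {a} {b} a∼b ta≤R =
      [ (λ ta≤tb → ≤R-upward (top-∈T a) (ta≤tb , Adj⇒≢ ta∼tb) ta≤R)
      , (λ tb≤ta → ≤-trans tb≤ta ta≤R) ]′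
        (ac (top a) (top b) ta∼tb)
      where
      ta∼tb : Adj Γ (κ (top a)) (κ (top b))
      ta∼tb = subst₂ (Adj Γ) (sym (κ-top a)) (sym (κ-top b)) a∼b

    -- Whether the top of the colour of z lies below R is invariant along covers, hence,
    -- by connectedness, everywhere equal to its value at R.
    ≤-R : ∀ z → z ≤P R
    ≤-R z =
      ≤-trans (≤-top z) (Equivalence.to (connected-invariant cover-invariant (connected R z)) top-R≤R)
      where
      cover-invariant : ∀ {x y} → Covers y x → (top (κ x) ≤P R) ⇔ (top (κ y) ≤P R)
      cover-invariant y⋗x = mk⇔ (top-≤R-adjacent (na _ _ y⋗x)) (top-≤R-adjacent (cover-Adj y⋗x))
      top-R≤R : top (κ R) ≤P R
      top-R≤R = ≤-reflexive (T-colour-injective (top-∈T (κ R)) R-∈T (κ-top (κ R)))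

    trunk-above : ∀ {y} → inT y → y ≢ R → Trunk R
    trunk-above {y} y∈T y≢R =
      let (d , R⋗d , y≤d) = cover-below (≤-R y , y≢R)
          (z , z≢R , κz≡κR) = slant d R (T-upward-closed y∈T y≤d) R-∈T R⋗d
      in R-∈T , (z , κz≡κR , ≤-R z , z≢R) , λ p⋗R → ⊥-elim (R-maximal _ (proj₁ p⋗R))

    R-trunk : TMoreThanOne P → Trunk R
    R-trunk (x , y , x∈T , y∈T , x≢y) with x ≟ R
    ... | yes refl = trunk-above y∈T (x≢y ∘ sym)
    ... | no x≢R   = trunk-above x∈T x≢R

    module Shape {β u v eu ev} (trunk : TChain R β)
                 (u≢v : u ≢ v) (β⋗u : Child β u) (β⋗v : Child β v)
                 (only : ∀ d → Child β d → d ≡ u ⊎ d ≡ v)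
                 (branch-u : TChain u eu) (leaf-u : Leaf eu) (branch-v : TChain v ev) (leaf-v : Leaf ev)
                 where
      private
        module T = TChain trunk
        module U = TChain branch-u
        module V = TChain branch-v

      I J K : ℕ
      I = ℕ.suc T.L
      J = ℕ.suc U.L
      K = ℕ.suc V.L

      φ : YElem I J K → Fin m
      φ (inj₁ r)        = T.at r
      φ (inj₂ (inj₁ s)) = U.at s
      φ (inj₂ (inj₂ s)) = V.at s

      φ-∈T : ∀ p → inT (φ p)
      φ-∈T (inj₁ r)        = T.at-∈T r
      φ-∈T (inj₂ (inj₁ s)) = U.at-∈T s
      φ-∈T (inj₂ (inj₂ s)) = V.at-∈T s

      u<trunk : ∀ s r → U.at s <P T.at r
      u<trunk s r = <-≤-trans (≤-<-trans (U.at-≤-head s) (proj₁ (proj₂ β⋗u))) (T.last-≤-at r)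

      v<trunk : ∀ s r → V.at s <P T.at r
      v<trunk s r = <-≤-trans (≤-<-trans (V.at-≤-head s) (proj₁ (proj₂ β⋗v))) (T.last-≤-at r)

      u≢v-branches : ∀ s s' → U.at s ≢ V.at s'
      u≢v-branches s s' eq =
        siblings-disjoint (proj₂ β⋗u) (proj₂ β⋗v) u≢v (U.at-∈T s) (U.at-≤-head s)
                          (subst (_≤P v) (sym eq) (V.at-≤-head s'))

      φ-injective : ∀ p q → φ p ≡ φ q → p ≡ q
      φ-injective (inj₁ r)        (inj₁ r')        eq = cong inj₁ (T.at-injective eq)
      φ-injective (inj₂ (inj₁ s)) (inj₂ (inj₁ s')) eq = cong (inj₂ ∘ inj₁) (U.at-injective eq)
      φ-injective (inj₂ (inj₂ s)) (inj₂ (inj₂ s')) eq = cong (inj₂ ∘ inj₂) (V.at-injective eq)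
      φ-injective (inj₁ r)        (inj₂ (inj₁ s))  eq = ⊥-elim (<-irrefl (sym eq) (u<trunk s r))
      φ-injective (inj₁ r)        (inj₂ (inj₂ s))  eq = ⊥-elim (<-irrefl (sym eq) (v<trunk s r))
      φ-injective (inj₂ (inj₁ s)) (inj₁ r)         eq = ⊥-elim (<-irrefl eq (u<trunk s r))
      φ-injective (inj₂ (inj₂ s)) (inj₁ r)         eq = ⊥-elim (<-irrefl eq (v<trunk s r))
      φ-injective (inj₂ (inj₁ s)) (inj₂ (inj₂ s')) eq = ⊥-elim (u≢v-branches s s' eq)
      φ-injective (inj₂ (inj₂ s)) (inj₂ (inj₁ s')) eq = ⊥-elim (u≢v-branches s' s (sym eq))

      φ-surjective : ∀ y → inT y → ∃[ p ] φ p ≡ y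
      φ-surjective y y∈T with T.at-complete y y∈T (≤-R y)
      ... | inj₁ (r , y≡) = inj₁ r , sym y≡
      ... | inj₂ y<β with cover-below y<β
      ...   | d , β⋗d , y≤d with only d (T-upward-closed y∈T y≤d , β⋗d)
      ...     | inj₁ refl =
        let (s , y≡) = leaf-chain-complete branch-u leaf-u y∈T y≤d in inj₂ (inj₁ s) , sym y≡
      ...     | inj₂ refl =
        let (s , y≡) = leaf-chain-complete branch-v leaf-v y∈T y≤d in inj₂ (inj₂ s) , sym y≡

      φ-covers : ∀ p q → YCov I J K p q → Covers (φ p) (φ q)
      φ-covers _ _ (YCov.tt r s s≡1+r) = T.at-covers r s s≡1+r
      φ-covers _ _ (YCov.uu r s s≡1+r) = U.at-covers r s s≡1+r
      φ-covers _ _ (YCov.vv r s s≡1+r) = V.at-covers r s s≡1+r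
      φ-covers _ _ (YCov.tu r s r≡L s≡0) =
        subst₂ Covers (sym (T.at-last r r≡L)) (sym (U.at-head s s≡0)) (proj₂ β⋗u)
      φ-covers _ _ (YCov.tv r s r≡L s≡0) =
        subst₂ Covers (sym (T.at-last r r≡L)) (sym (V.at-head s s≡0)) (proj₂ β⋗v)

      φ-root-or-covered : ∀ q → φ q ≡ R ⊎ ∃[ p ] YCov I J K p q
      φ-root-or-covered (inj₁ zero)           = inj₁ T.head
      φ-root-or-covered (inj₁ (suc r))        =
        inj₂ (inj₁ (inject₁ r) , YCov.tt _ _ (cong ℕ.suc (sym (FinP.toℕ-inject₁ r))))
      φ-root-or-covered (inj₂ (inj₁ zero))    =
        inj₂ (inj₁ (fromℕ T.L) , YCov.tu _ _ (FinP.toℕ-fromℕ T.L) refl)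
      φ-root-or-covered (inj₂ (inj₁ (suc s))) =
        inj₂ (inj₂ (inj₁ (inject₁ s)) , YCov.uu _ _ (cong ℕ.suc (sym (FinP.toℕ-inject₁ s))))
      φ-root-or-covered (inj₂ (inj₂ zero))    =
        inj₂ (inj₁ (fromℕ T.L) , YCov.tv _ _ (FinP.toℕ-fromℕ T.L) refl)
      φ-root-or-covered (inj₂ (inj₂ (suc s))) =
        inj₂ (inj₂ (inj₂ (inject₁ s)) , YCov.vv _ _ (cong ℕ.suc (sym (FinP.toℕ-inject₁ s))))

      φ-reflects-covers : ∀ p q → TCovers (φ p) (φ q) → YCov I J K p q
      φ-reflects-covers p q p⋗q with TCovers⇒Covers (φ-∈T q) p⋗q | φ-root-or-covered q
      ... | p⋗q′ | inj₁ q≡R = ⊥-elim (R-maximal (φ p) (subst (_<P φ p) q≡R (proj₁ p⋗q′)))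
      ... | p⋗q′ | inj₂ (p₀ , p₀⋗q) =
        subst (λ p → YCov I J K p q)
              (φ-injective p₀ p (cover-of-T-unique (φ-∈T q) (φ-covers p₀ q p₀⋗q) p⋗q′)) p₀⋗q

      shape : HasShapeY P I J K
      shape = φ , φ-injective , φ-∈T , φ-surjective ,
              (λ p q → Covers⇒TCovers (φ-∈T q) ∘ φ-covers p q) , φ-reflects-covers

    fork-shape : ∀ {β} → TChain R β → Fork β →
                 ∃[ i ] ∃[ j ] ∃[ k ] (1 ≤ i × 1 ≤ j × j ≤ k × HasShapeY P i j k)
    fork-shape {β} trunk (u , v , u≢v , β⋗u , β⋗v , only , u-gaps , v-gaps)
      with branch-descent (proj₁ β⋗u , β , proj₂ β⋗u , u-gaps)
         | branch-descent (proj₁ β⋗v , β , proj₂ β⋗v , v-gaps)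
    ... | _ , branch-u , leaf-u | _ , branch-v , leaf-v with TChain.L branch-u ℕP.≤? TChain.L branch-v
    ...   | yes Lu≤Lv = _ , _ , _ , s≤s z≤n , s≤s z≤n , s≤s Lu≤Lv ,
                        Shape.shape trunk u≢v β⋗u β⋗v only branch-u leaf-u branch-v leaf-v
    ...   | no Lu≰Lv  = _ , _ , _ , s≤s z≤n , s≤s z≤n , s≤s (ℕP.≰⇒≥ Lu≰Lv) ,
                        Shape.shape trunk (u≢v ∘ sym) β⋗v β⋗u (λ d → swap ∘ only d)
                                    branch-v leaf-v branch-u leaf-u

  top-tree-shape : TMoreThanOne P →
                   ∃[ i ] ∃[ j ] ∃[ k ] (1 ≤ i × 1 ≤ j × j ≤ k × HasShapeY P i j k)
  top-tree-shape T>1@(x , _) =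
    let (R , R-maximal) = maximal-element x
        open BelowRoot R R-maximal
        (_ , trunk , fork) = trunk-descent (R-trunk T>1)
    in fork-shape trunk fork

corollary5p5 : (Γ : Dynkin) → SimplyLaced Γ → (P : ColoredPoset Γ) →
    Poset.DComplete P → Poset.SlantIrreducible P → TMoreThanOne P →
    ∃[ i ] ∃[ j ] ∃[ k ] (1 ≤ i × 1 ≤ j × j ≤ k × HasShapeY P i j k)
corollary5p5 Γ SL P (ec , na , ac , ice2 , ucb1) SI = TopTree.top-tree-shape Γ SL P ec na ac ice2 ucb1 SI
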